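{- Let $k\ge 0$ and $n\ge 0$ be integers. Then $a(n,k)$ equals the number of walks of length $n$ on the path graph $P_{k+1}$ with vertex set $\{1,2,\dots,k+1\}$ and edges $\{i,i+1\}$ ($1\le i\le k$) which start at vertex $1$ (and end at any vertex).
   Context: Up-step $U:(i,j)\to(i+1,j+1)$, down-step $D:(i,j)\to(i+1,j-1)$. For integers $n,k\ge 0$, $A_{n,k}$ is the set of lattice paths of length $n$ consisting of $U$ and $D$ steps that start at $(0,0)$, end at height $0$ or $-1$, and stay in the strip $-\lfloor (k+1)/2\rfloor\le y\le \lfloor k/2\rfloor$. Set $a(n,k)=|A_{n,k}|$. -}

module Defs where

open import Data.Nat as ℕ using (ℕ; zero; suc; _/_)
open import Data.Integer as ℤ using (ℤ; +_; -_; _+_; _≤_; _≤?_)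
open import Data.Fin as Fin using (Fin; toℕ)
open import Data.Vec as Vec using (Vec; []; _∷_)
open import Data.List as List using (List; []; _∷_; length; filter; concatMap; map; allFin)
open import Data.Product using (_×_; _,_)
open import Data.Sum using (_⊎_)
open import Relation.Binary.PropositionalEquality using (_≡_)
open import Relation.Nullary using (Dec; yes; no)
open import Relation.Nullary.Decidable using (_×-dec_; _⊎-dec_)
open import Data.List.Relation.Unary.All as All using (All)
open import Relation.Unary using (Decidable)

data Step : Set where
  U D : Step

allSteps : List Step
allSteps = U ∷ D ∷ []

allVecs : {A : Set} → List A → (n : ℕ) → List (Vec A n)
allVecs xs zero    = [] ∷ []
allVecs xs (suc n) = concatMap (λ x → map (x ∷_) (allVecs xs n)) xs

stepVal : Step → ℤ
stepVal U = + 1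
stepVal D = - (+ 1)

heights : {n : ℕ} → ℤ → Vec Step n → List ℤ
heights h []       = h ∷ []
heights h (s ∷ ss) = h ∷ heights (h + stepVal s) ss

finalHeight : {n : ℕ} → ℤ → Vec Step n → ℤ
finalHeight h []       = h
finalHeight h (s ∷ ss) = finalHeight (h + stepVal s) ss

InStrip : ℕ → ℤ → Set
InStrip k y = (- (+ (suc k / 2)) ≤ y) × (y ≤ + (k / 2))

inStrip? : (k : ℕ) → Decidable (InStrip k)
inStrip? k y = (- (+ (suc k / 2)) ≤? y) ×-dec (y ≤? + (k / 2))

InA : (n k : ℕ) → Vec Step n → Set
InA n k p = ((finalHeight (+ 0) p ≡ + 0) ⊎ (finalHeight (+ 0) p ≡ - (+ 1)))
            × All (InStrip k) (heights (+ 0) p)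

inA? : (n k : ℕ) → Decidable (InA n k)
inA? n k p = ((finalHeight (+ 0) p ℤ.≟ + 0) ⊎-dec (finalHeight (+ 0) p ℤ.≟ - (+ 1)))
             ×-dec All.all? (inStrip? k) (heights (+ 0) p)

a : ℕ → ℕ → ℕ
a n k = length (filter (inA? n k) (allVecs allSteps n))

-- Path graph P_{k+1}: vertices Fin (suc k), where Fin index i stands for vertex i+1;
-- i and j adjacent iff |i - j| = 1
Adj : {m : ℕ} → Fin m → Fin m → Set
Adj i j = (suc (toℕ i) ≡ toℕ j) ⊎ (suc (toℕ j) ≡ toℕ i)

adj? : {m : ℕ} → (i j : Fin m) → Dec (Adj i j)
adj? i j = (suc (toℕ i) ℕ.≟ toℕ j) ⊎-dec (suc (toℕ j) ℕ.≟ toℕ i)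

IsWalkFrom : {m n : ℕ} → Fin m → Vec (Fin m) n → Set
IsWalkFrom v []       = Data.Unit.⊤ where import Data.Unit
IsWalkFrom v (w ∷ ws) = Adj v w × IsWalkFrom w ws

isWalkFrom? : {m n : ℕ} → (v : Fin m) → (ws : Vec (Fin m) n) → Dec (IsWalkFrom v ws)
isWalkFrom? v []       = yes Data.Unit.tt where import Data.Unit
isWalkFrom? v (w ∷ ws) = adj? v w ×-dec isWalkFrom? w ws

-- number of walks of length n in P_{k+1} starting at vertex 1 (Fin index 0):
-- walks v_0 = 1, v_1, ..., v_n, determined by the sequence (v_1,...,v_n)
pathWalks : ℕ → ℕ → ℕ
pathWalks n k = length (filter (isWalkFrom? {suc k} Fin.zero) (allVecs (allFin (suc k)) n))

module Submission where

-- Let A be the walk operator of the strip -m ≤ y ≤ h (m = ⌈k/2⌉, h = ⌊k/2⌋), i.e. the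
-- adjacency operator of the path on its k+1 heights. Then a(n,k) = (Aⁿχ)(0) with χ the
-- indicator of {-1, 0}, while the walks on P_{k+1} from an end vertex number (Aⁿ𝟙)(-m).
-- The Chebyshev operators U_j(A) commute with A, and since A is symmetric,
-- (U_j(A) f)(-m) = f(-m + j) for j ≤ k. Moreover, for j ≤ m, U_j(A) χ is the indicator of
-- [-1-j, j] within the strip (the recurrence only needs the smaller intervals to fit in
-- the strip), so U_m(A) χ = 𝟙. Hence
--   (Aⁿχ)(0) = (U_m(A) Aⁿχ)(-m) = (Aⁿ U_m(A) χ)(-m) = (Aⁿ𝟙)(-m).

open import Defs
open import Data.Nat as ℕ using (ℕ; zero; suc; z≤n; s≤s; _/_; ⌊_/2⌋)
import Data.Nat.Properties as ℕP
open import Data.Nat.DivMod using (m/n≡1+[m∸n]/n)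
open import Data.Nat.ListAction using (sum)
open import Data.Integer as ℤ using (ℤ; +_; -_; _+_; _-_; _≤_; _<_; _≤?_; 0ℤ; 1ℤ; +≤+; +<+; -<+)
import Data.Integer.Properties as ℤP
open import Data.Integer.Tactic.RingSolver using (solve-∀)
open import Data.Fin as Fin using (Fin; toℕ)
import Data.Fin.Properties as FP
open import Data.Vec using (Vec; []; _∷_)
open import Data.List using (List; []; _∷_; _++_; length; filter; concatMap; map; tabulate; allFin)
import Data.List.Properties as LP
open import Data.List.Relation.Unary.All as All using (All; []; _∷_)
open import Data.Product using (_×_; _,_; proj₁; proj₂)
open import Data.Sum using (_⊎_)
open import Data.Empty using (⊥; ⊥-elim)
open import Data.Bool using (true; false; if_then_else_)
open import Function using (_∘_)
open import Relation.Binary.PropositionalEquality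
open import Relation.Nullary using (Dec; yes; no; does; ¬_)
open import Relation.Nullary.Decidable using (_×-dec_; _⊎-dec_)
open import Relation.Unary using (Decidable)

ind : ∀ {p} {P : Set p} → Dec P → ℤ → ℤ
ind d x = if does d then x else 0ℤ

module _ {p} {P : Set p} where

  ind-yes : (d : Dec P) {x : ℤ} → P → ind d x ≡ x
  ind-yes (yes _) _  = refl
  ind-yes (no ¬p) p = ⊥-elim (¬p p)

  ind-no : (d : Dec P) {x : ℤ} → ¬ P → ind d x ≡ 0ℤ
  ind-no (yes p) ¬p = ⊥-elim (¬p p)
  ind-no (no _)  _  = refl

  ind-0ℤ : (d : Dec P) → ind d 0ℤ ≡ 0ℤ
  ind-0ℤ (yes _) = refl
  ind-0ℤ (no _)  = refl

  ind-sub : (d : Dec P) (x y : ℤ) → ind d x - ind d y ≡ ind d (x - y)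
  ind-sub (yes _) x y = refl
  ind-sub (no _)  x y = refl

  ind-congʳ : (d : Dec P) {x y : ℤ} → (P → x ≡ y) → ind d x ≡ ind d y
  ind-congʳ (yes p) x≡y = x≡y p
  ind-congʳ (no _)  _   = refl

  ind-id : (d : Dec P) {x : ℤ} → (¬ P → x ≡ 0ℤ) → ind d x ≡ x
  ind-id (yes _)  _   = refl
  ind-id (no ¬p) x≡0 = sym (x≡0 ¬p)

module _ {p q} {P : Set p} {Q : Set q} where

  ind-cong : (P → Q) → (Q → P) → (d : Dec P) (e : Dec Q) {x : ℤ} → ind d x ≡ ind e x
  ind-cong f g (yes p) (yes q) = refl
  ind-cong f g (yes p) (no ¬q) = ⊥-elim (¬q (f p))
  ind-cong f g (no ¬p) (yes q) = ⊥-elim (¬p (g q))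
  ind-cong f g (no ¬p) (no ¬q) = refl

  ind-× : (d : Dec P) (e : Dec Q) {x : ℤ} → ind (d ×-dec e) x ≡ ind d (ind e x)
  ind-× (yes _) (yes _) = refl
  ind-× (yes _) (no _)  = refl
  ind-× (no _)  (yes _) = refl
  ind-× (no _)  (no _)  = refl

  ind-⊎ : (d : Dec P) (e : Dec Q) {x : ℤ} → (P → Q → ⊥) → ind (d ⊎-dec e) x ≡ ind d x + ind e x
  ind-⊎ (yes p) (yes q) h = ⊥-elim (h p q)
  ind-⊎ (yes _) (no _) {x} _ = sym (ℤP.+-identityʳ x)
  ind-⊎ (no _)  (yes _) {x} _ = sym (ℤP.+-identityˡ x)
  ind-⊎ (no _)  (no _)  _ = refl

-- Walks in a strip

module Strip (lo hi : ℤ) where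

  Inside : ℤ → Set
  Inside s = (lo ≤ s) × (s ≤ hi)

  inside? : (s : ℤ) → Dec (Inside s)
  inside? s = (lo ≤? s) ×-dec (s ≤? hi)

  restrict : (ℤ → ℤ) → ℤ → ℤ
  restrict f s = ind (inside? s) (f s)

  step : (ℤ → ℤ) → ℤ → ℤ
  step f s = ind (inside? s) (f (s + 1ℤ) + f (s - 1ℤ))

  steps : ℕ → (ℤ → ℤ) → ℤ → ℤ
  steps zero    f = f
  steps (suc n) f = step (steps n f)

  -- walk n f s sums f over the endpoints of the length-n walks from s that stay in the strip.
  walk : ℕ → (ℤ → ℤ) → ℤ → ℤ
  walk n f = steps n (restrict f)

  step-inside : ∀ f {s} → Inside s → step f s ≡ f (s + 1ℤ) + f (s - 1ℤ)
  step-inside f {s} = ind-yes (inside? s)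

  walk-outside : ∀ n f {s} → ¬ Inside s → walk n f s ≡ 0ℤ
  walk-outside zero    f {s} = ind-no (inside? s)
  walk-outside (suc n) f {s} = ind-no (inside? s)

  restrict-cong : ∀ {f g} → (∀ {s} → Inside s → f s ≡ g s) → restrict f ≗ restrict g
  restrict-cong f≡g s = ind-congʳ (inside? s) f≡g

  restrict-id : ∀ {f} → (∀ {s} → ¬ Inside s → f s ≡ 0ℤ) → restrict f ≗ f
  restrict-id f≡0 s = ind-id (inside? s) f≡0

  step-cong : ∀ {f g} → f ≗ g → step f ≗ step g
  step-cong f≗g s = cong (ind (inside? s)) (cong₂ _+_ (f≗g (s + 1ℤ)) (f≗g (s - 1ℤ)))

  steps-cong : ∀ n {f g} → f ≗ g → steps n f ≗ steps n g
  steps-cong zero    f≗g = f≗g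
  steps-cong (suc n) f≗g = step-cong (steps-cong n f≗g)

  step-sub : ∀ f g s → step f s - step g s ≡ step (λ t → f t - g t) s
  step-sub f g s = trans (ind-sub (inside? s) _ _)
                         (cong (ind (inside? s))
                               (regroup (f (s + 1ℤ)) (f (s - 1ℤ)) (g (s + 1ℤ)) (g (s - 1ℤ))))
    where
    regroup : ∀ a b c d → a + b - (c + d) ≡ a - c + (b - d)
    regroup = solve-∀

  -- cheb (suc j) = U_j(step), with U_j the Chebyshev polynomials of the second kind.
  cheb : ℕ → (ℤ → ℤ) → ℤ → ℤ
  cheb zero          f s = 0ℤ
  cheb (suc zero)    f s = f s
  cheb (suc (suc j)) f s = step (cheb (suc j) f) s - cheb j f s

  cheb-step : ∀ j f → cheb j (step f) ≗ step (cheb j f)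
  cheb-step zero          f s = sym (ind-0ℤ (inside? s))
  cheb-step (suc zero)    f s = refl
  cheb-step (suc (suc j)) f s = begin
    step (cheb (suc j) (step f)) s - cheb j (step f) s
      ≡⟨ cong₂ _-_ (step-cong (cheb-step (suc j) f) s) (cheb-step j f s) ⟩
    step (step (cheb (suc j) f)) s - step (cheb j f) s
      ≡⟨ step-sub (step (cheb (suc j) f)) (cheb j f) s ⟩
    step (cheb (suc (suc j)) f) s ∎
    where open ≡-Reasoning

  cheb-steps : ∀ j n f → cheb j (steps n f) ≗ steps n (cheb j f)
  cheb-steps j zero    f s = refl
  cheb-steps j (suc n) f s =
    trans (cheb-step j (steps n f) s) (step-cong (cheb-steps j n f) s)

  lo-1-outside : ¬ Inside (lo - 1ℤ)
  lo-1-outside (lo≤lo-1 , _) =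
    ℤP.<⇒≱ (ℤP.i≤pred[j]⇒i<j (ℤP.≤-reflexive (ℤP.+-comm lo (- 1ℤ)))) lo≤lo-1

  cheb-bottom-suc : ∀ j f → cheb (suc j) (step f) lo ≡ step f (lo + + j) →
                    cheb j f lo ≡ f (lo + + j - 1ℤ) → lo + + j ≤ hi →
                    cheb (suc (suc j)) f lo ≡ f (lo + + suc j)
  cheb-bottom-suc j f top below lo+j≤hi = begin
    step (cheb (suc j) f) lo - cheb j f lo
      ≡⟨ cong₂ _-_ (sym (cheb-step (suc j) f lo)) below ⟩
    cheb (suc j) (step f) lo - f (lo + + j - 1ℤ)
      ≡⟨ cong (_- f (lo + + j - 1ℤ)) (trans top (step-inside f (ℤP.i≤i+j lo (+ j) , lo+j≤hi))) ⟩
    f (lo + + j + 1ℤ) + f (lo + + j - 1ℤ) - f (lo + + j - 1ℤ)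
      ≡⟨ cancel (f (lo + + j + 1ℤ)) (f (lo + + j - 1ℤ)) ⟩
    f (lo + + j + 1ℤ)
      ≡⟨ cong f (shift lo (+ j)) ⟩
    f (lo + + suc j) ∎
    where
    open ≡-Reasoning
    cancel : ∀ x y → x + y - y ≡ x
    cancel = solve-∀
    shift : ∀ l i → l + i + 1ℤ ≡ l + (1ℤ + i)
    shift = solve-∀

  -- As step is symmetric, this says that U_j(step) sends the indicator of lo to that of lo + j.
  cheb-bottom : ∀ j f → f (lo - 1ℤ) ≡ 0ℤ → lo + + j ≤ hi → cheb (suc j) f lo ≡ f (lo + + j)
  cheb-bottom zero f _ _ = cong f (sym (ℤP.+-identityʳ lo))
  cheb-bottom (suc zero) f f[lo-1]≡0 lo+1≤hi =
    cheb-bottom-suc zero f (cheb-bottom zero (step f) (ind-no (inside? (lo - 1ℤ)) lo-1-outside) lo≤hi)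
                    (trans (sym f[lo-1]≡0) (cong (λ t → f (t - 1ℤ)) (sym (ℤP.+-identityʳ lo)))) lo≤hi
    where
    lo≤hi : lo + + 0 ≤ hi
    lo≤hi = ℤP.≤-trans (ℤP.+-monoʳ-≤ lo (+≤+ z≤n)) lo+1≤hi
  cheb-bottom (suc (suc j)) f f[lo-1]≡0 lo+j+2≤hi =
    cheb-bottom-suc (suc j) f
      (cheb-bottom (suc j) (step f) (ind-no (inside? (lo - 1ℤ)) lo-1-outside) lo+j+1≤hi)
      (trans (cheb-bottom j f f[lo-1]≡0 lo+j≤hi) (cong f (shift lo (+ j)))) lo+j+1≤hi
    where
    shift : ∀ l i → l + i ≡ l + (1ℤ + i) - 1ℤ
    shift = solve-∀
    lo+j+1≤hi : lo + + suc j ≤ hi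
    lo+j+1≤hi = ℤP.≤-trans (ℤP.+-monoʳ-≤ lo (+≤+ (ℕP.n≤1+n (suc j)))) lo+j+2≤hi
    lo+j≤hi : lo + + j ≤ hi
    lo+j≤hi = ℤP.≤-trans (ℤP.+-monoʳ-≤ lo (+≤+ (ℕP.n≤1+n j))) lo+j+1≤hi

heaviside : ℤ → ℤ
heaviside x = ind (0ℤ ≤? x) 1ℤ

-- The indicator of [-i, i-1], written as a difference of Heaviside steps so
-- that its three-term recurrence below is a ring identity.
box : ℕ → ℤ → ℤ
box i s = heaviside (s + + i) - heaviside (s - + i)

heaviside-nonneg : ∀ {x} → 0ℤ ≤ x → heaviside x ≡ 1ℤ
heaviside-nonneg {x} = ind-yes (0ℤ ≤? x)

heaviside-neg : ∀ {x} → x < 0ℤ → heaviside x ≡ 0ℤ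
heaviside-neg {x} x<0 = ind-no (0ℤ ≤? x) (ℤP.<⇒≱ x<0)

box-zero : ∀ s → box 0 s ≡ 0ℤ
box-zero s = ℤP.+-inverseʳ (heaviside (s + + 0))

box-one : ∀ s → ind ((s ℤ.≟ 0ℤ) ⊎-dec (s ℤ.≟ - 1ℤ)) 1ℤ ≡ box 1 s
box-one (+ zero)          = refl
box-one (+ suc n)         = refl
box-one ℤ.-[1+ zero ]     = refl
box-one ℤ.-[1+ suc n ]    = refl

box-suc : ∀ j s → box (suc j) (s + 1ℤ) + box (suc j) (s - 1ℤ) ≡ box (suc (suc j)) s + box j s
box-suc j s =
  trans (cong₂ _+_ (cong₂ (λ a b → H a - H b) (up s (+ j)) (mid s (+ j)))
                   (cong₂ (λ a b → H a - H b) (mid′ s (+ j)) (down s (+ j))))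
        (swap (H (s + + suc (suc j))) (H (s - + j)) (H (s + + j)) (H (s - + suc (suc j))))
  where
  H : ℤ → ℤ
  H = heaviside
  up : ∀ s i → s + 1ℤ + (1ℤ + i) ≡ s + (1ℤ + (1ℤ + i))
  up = solve-∀
  mid : ∀ s i → s + 1ℤ - (1ℤ + i) ≡ s - i
  mid = solve-∀
  mid′ : ∀ s i → s - 1ℤ + (1ℤ + i) ≡ s + i
  mid′ = solve-∀
  down : ∀ s i → s - 1ℤ - (1ℤ + i) ≡ s - (1ℤ + (1ℤ + i))
  down = solve-∀
  swap : ∀ a b c d → a - b + (c - d) ≡ a - d + (c - b)
  swap = solve-∀

-- Walks from the middle of the strip and from its bottom row

module CentredStrip (m h : ℕ) (h≤m : h ℕ.≤ m) (m≤1+h : m ℕ.≤ suc h) where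

  open Strip (- + m) (+ h)

  box-outside : ∀ i → i ℕ.≤ m → ∀ {s} → ¬ Inside s → box i s ≡ 0ℤ
  box-outside i i≤m {s} out with - + m ≤? s
  ... | no -m≰s =
    cong₂ _-_ (heaviside-neg s+i<0) (heaviside-neg (ℤP.≤-<-trans (ℤP.i-j≤i s (+ i)) s<0))
    where
    s<-m : s < - + m
    s<-m = ℤP.≰⇒> -m≰s
    s<0 : s < 0ℤ
    s<0 = ℤP.<-≤-trans s<-m ℤP.neg-≤-pos
    s+i<0 : s + + i < 0ℤ
    s+i<0 = ℤP.<-≤-trans (ℤP.+-monoˡ-< (+ i) s<-m)
              (ℤP.≤-trans (ℤP.+-monoʳ-≤ (- + m) (+≤+ i≤m))
                          (ℤP.≤-reflexive (ℤP.+-inverseˡ (+ m))))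
  ... | yes -m≤s = cong₂ _-_ (heaviside-nonneg (ℤP.≤-trans 0≤s-i s-i≤s+i)) (heaviside-nonneg 0≤s-i)
    where
    i≤s : + i ≤ s
    i≤s = ℤP.≤-trans (+≤+ (ℕP.≤-trans i≤m m≤1+h))
                     (ℤP.i<j⇒suc[i]≤j (ℤP.≰⇒> (λ s≤h → out (-m≤s , s≤h))))
    0≤s-i : 0ℤ ≤ s - + i
    0≤s-i = ℤP.i≤j⇒0≤j-i i≤s
    s-i≤s+i : s - + i ≤ s + + i
    s-i≤s+i = ℤP.≤-trans (ℤP.i-j≤i s (+ i)) (ℤP.i≤i+j s (+ i))

  box-inside : ∀ {s} → Inside s → box (suc m) s ≡ 1ℤ
  box-inside {s} (-m≤s , s≤h) = cong₂ _-_ (heaviside-nonneg 0≤s+m+1) (heaviside-neg s-m-1<0)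
    where
    bottom : ∀ M → - M + (1ℤ + M) ≡ 1ℤ
    bottom = solve-∀
    top : ∀ M → M - (1ℤ + M) ≡ - 1ℤ
    top = solve-∀
    0≤s+m+1 : 0ℤ ≤ s + + suc m
    0≤s+m+1 = ℤP.≤-trans (+≤+ z≤n)
                (ℤP.≤-trans (ℤP.≤-reflexive (sym (bottom (+ m)))) (ℤP.+-monoˡ-≤ (+ suc m) -m≤s))
    s-m-1<0 : s - + suc m < 0ℤ
    s-m-1<0 = ℤP.≤-<-trans (ℤP.+-monoˡ-≤ (- + suc m) (ℤP.≤-trans s≤h (+≤+ h≤m)))
                (ℤP.≤-<-trans (ℤP.≤-reflexive (top (+ m))) -<+)

  cheb-box : ∀ j → j ℕ.≤ suc m → cheb j (restrict (box 1)) ≗ restrict (box j)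
  cheb-box zero          _   s = sym (trans (cong (ind (inside? s)) (box-zero s)) (ind-0ℤ (inside? s)))
  cheb-box (suc zero)    _   s = refl
  cheb-box (suc (suc j)) j+2≤m+1 s = begin
    step (cheb (suc j) (restrict (box 1))) s - cheb j (restrict (box 1)) s
      ≡⟨ cong₂ _-_ (step-cong (cheb-box (suc j) j+1≤m+1) s) (cheb-box j j≤m+1 s) ⟩
    step (restrict (box (suc j))) s - restrict (box j) s
      ≡⟨ cong (_- restrict (box j) s) (step-cong (restrict-id (box-outside (suc j) j+1≤m)) s) ⟩
    step (box (suc j)) s - restrict (box j) s
      ≡⟨ cong (λ t → ind (inside? s) t - restrict (box j) s) (box-suc j s) ⟩
    ind (inside? s) (box (suc (suc j)) s + box j s) - ind (inside? s) (box j s)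
      ≡⟨ ind-sub (inside? s) _ _ ⟩
    ind (inside? s) (box (suc (suc j)) s + box j s - box j s)
      ≡⟨ cong (ind (inside? s)) (cancel (box (suc (suc j)) s) (box j s)) ⟩
    restrict (box (suc (suc j))) s ∎
    where
    open ≡-Reasoning
    cancel : ∀ x y → x + y - y ≡ x
    cancel = solve-∀
    j+1≤m : suc j ℕ.≤ m
    j+1≤m = ℕ.s≤s⁻¹ j+2≤m+1
    j+1≤m+1 : suc j ℕ.≤ suc m
    j+1≤m+1 = ℕP.m≤n⇒m≤1+n j+1≤m
    j≤m+1 : j ℕ.≤ suc m
    j≤m+1 = ℕP.m≤n⇒m≤1+n (ℕP.<⇒≤ j+1≤m)

  middle≡bottom : ∀ n → walk n (box 1) 0ℤ ≡ walk n (λ _ → 1ℤ) (- + m)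
  middle≡bottom n = begin
    walk n (box 1) 0ℤ
      ≡⟨ cong (walk n (box 1)) (sym (ℤP.+-inverseˡ (+ m))) ⟩
    walk n (box 1) (- + m + + m)
      ≡⟨ sym (cheb-bottom m (walk n (box 1)) (walk-outside n (box 1) lo-1-outside)
                          (ℤP.≤-trans (ℤP.≤-reflexive (ℤP.+-inverseˡ (+ m))) (+≤+ z≤n))) ⟩
    cheb (suc m) (walk n (box 1)) (- + m)
      ≡⟨ cheb-steps (suc m) n (restrict (box 1)) (- + m) ⟩
    steps n (cheb (suc m) (restrict (box 1))) (- + m)
      ≡⟨ steps-cong n (cheb-box (suc m) ℕP.≤-refl) (- + m) ⟩
    steps n (restrict (box (suc m))) (- + m)
      ≡⟨ steps-cong n (restrict-cong box-inside) (- + m) ⟩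
    walk n (λ _ → 1ℤ) (- + m) ∎
    where open ≡-Reasoning

module _ {A B : Set} {P : B → Set} (P? : Decidable P) where

  length-filter-map : ∀ {Q : A → Set} (Q? : Decidable Q) (f : A → B) →
                      (∀ {x} → P (f x) → Q x) → (∀ {x} → Q x → P (f x)) →
                      ∀ xs → length (filter P? (map f xs)) ≡ length (filter Q? xs)
  length-filter-map Q? f to from [] = refl
  length-filter-map Q? f to from (x ∷ xs) with P? (f x) | Q? x
  ... | yes _ | yes _ = cong suc (length-filter-map Q? f to from xs)
  ... | yes p | no ¬q = ⊥-elim (¬q (to p))
  ... | no ¬p | yes q = ⊥-elim (¬p (from q))
  ... | no _  | no _  = length-filter-map Q? f to from xs

  length-filter-concatMap : (g : A → List B) → ∀ xs →
    length (filter P? (concatMap g xs)) ≡ sum (map (λ x → length (filter P? (g x))) xs)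
  length-filter-concatMap g [] = refl
  length-filter-concatMap g (x ∷ xs) = begin
    length (filter P? (g x ++ concatMap g xs))
      ≡⟨ cong length (LP.filter-++ P? (g x) (concatMap g xs)) ⟩
    length (filter P? (g x) ++ filter P? (concatMap g xs))
      ≡⟨ LP.length-++ (filter P? (g x)) ⟩
    length (filter P? (g x)) ℕ.+ length (filter P? (concatMap g xs))
      ≡⟨ cong (length (filter P? (g x)) ℕ.+_) (length-filter-concatMap g xs) ⟩
    sum (map (λ x → length (filter P? (g x))) (x ∷ xs)) ∎
    where open ≡-Reasoning

length-filter-[x] : ∀ {A : Set} {P : A → Set} (P? : Decidable P) x →
                    + length (filter P? (x ∷ [])) ≡ ind (P? x) 1ℤ
length-filter-[x] P? x with does (P? x)
... | true  = refl
... | false = refl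

length-filter-× : ∀ {A : Set} {P : Set} {Q : A → Set} (d : Dec P) (Q? : Decidable Q) xs →
                  + length (filter (λ x → d ×-dec Q? x) xs) ≡ ind d (+ length (filter Q? xs))
length-filter-× (yes p) Q? xs = cong (λ ys → + length ys) (LP.filter-≐ _ Q? (proj₂ , (p ,_)) xs)
length-filter-× (no ¬p) Q? xs =
  cong (λ ys → + length ys) (LP.filter-none _ (All.universal (λ _ → ¬p ∘ proj₁) xs))

sumTo : ℕ → (ℕ → ℤ) → ℤ
sumTo zero    f = 0ℤ
sumTo (suc N) f = f 0 + sumTo N (f ∘ suc)

sumTo-cong : ∀ N {f g} → f ≗ g → sumTo N f ≡ sumTo N g
sumTo-cong zero    f≗g = refl
sumTo-cong (suc N) f≗g = cong₂ _+_ (f≗g 0) (sumTo-cong N (f≗g ∘ suc))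

sumTo-zero : ∀ N {f} → (∀ i → f i ≡ 0ℤ) → sumTo N f ≡ 0ℤ
sumTo-zero zero    f≡0 = refl
sumTo-zero (suc N) f≡0 = cong₂ _+_ (f≡0 0) (sumTo-zero N (f≡0 ∘ suc))

sumTo-+ : ∀ N (f g : ℕ → ℤ) → sumTo N (λ i → f i + g i) ≡ sumTo N f + sumTo N g
sumTo-+ zero    f g = refl
sumTo-+ (suc N) f g = trans (cong (_+_ (f 0 + g 0)) (sumTo-+ N (f ∘ suc) (g ∘ suc)))
                            (swap (f 0) (g 0) (sumTo N (f ∘ suc)) (sumTo N (g ∘ suc)))
  where
  swap : ∀ a b c d → a + b + (c + d) ≡ a + c + (b + d)
  swap = solve-∀

sumTo-δ : ∀ N c (f : ℕ → ℤ) → sumTo N (λ i → ind (i ℕ.≟ c) (f i)) ≡ ind (c ℕ.<? N) (f c)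
sumTo-δ zero    c       f = refl
sumTo-δ (suc N) zero    f =
  trans (cong (_+_ (f 0)) (sumTo-zero N (λ i → ind-no (suc i ℕ.≟ 0) {f (suc i)} λ ())))
        (ℤP.+-identityʳ (f 0))
sumTo-δ (suc N) (suc c) f = begin
  0ℤ + sumTo N (λ i → ind (suc i ℕ.≟ suc c) (f (suc i)))
    ≡⟨ ℤP.+-identityˡ _ ⟩
  sumTo N (λ i → ind (suc i ℕ.≟ suc c) (f (suc i)))
    ≡⟨ sumTo-cong N (λ i → ind-cong ℕP.suc-injective (cong suc) (suc i ℕ.≟ suc c) (i ℕ.≟ c)) ⟩
  sumTo N (λ i → ind (i ℕ.≟ c) (f (suc i)))
    ≡⟨ sumTo-δ N c (f ∘ suc) ⟩
  ind (c ℕ.<? N) (f (suc c))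
    ≡⟨ ind-cong s≤s ℕ.s≤s⁻¹ (c ℕ.<? N) (suc c ℕ.<? suc N) ⟩
  ind (suc c ℕ.<? suc N) (f (suc c)) ∎
  where open ≡-Reasoning

sum-tabulate : ∀ {A : Set} N (f : Fin N → A) (g : A → ℕ) (φ : ℕ → ℤ) →
               (∀ i → + g (f i) ≡ φ (toℕ i)) → + sum (map g (tabulate f)) ≡ sumTo N φ
sum-tabulate zero    f g φ g≡φ = refl
sum-tabulate (suc N) f g φ g≡φ =
  cong₂ _+_ (g≡φ Fin.zero) (sum-tabulate N (f ∘ Fin.suc) g (φ ∘ suc) (g≡φ ∘ Fin.suc))

sumTo-neighbours : ∀ N v (G : ℤ → ℤ) → G (- 1ℤ) ≡ 0ℤ → G (+ N) ≡ 0ℤ → v ℕ.< N →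
  sumTo N (λ i → ind ((suc v ℕ.≟ i) ⊎-dec (suc i ℕ.≟ v)) (G (+ i))) ≡ G (+ suc v) + G (+ v - 1ℤ)
sumTo-neighbours N v G G[-1]≡0 G[N]≡0 v<N = begin
  sumTo N (λ i → ind ((suc v ℕ.≟ i) ⊎-dec (suc i ℕ.≟ v)) (G (+ i)))
    ≡⟨ sumTo-cong N (λ i → ind-⊎ (suc v ℕ.≟ i) (suc i ℕ.≟ v) not-both) ⟩
  sumTo N (λ i → ind (suc v ℕ.≟ i) (G (+ i)) + ind (suc i ℕ.≟ v) (G (+ i)))
    ≡⟨ sumTo-+ N _ _ ⟩
  sumTo N (λ i → ind (suc v ℕ.≟ i) (G (+ i))) + sumTo N (λ i → ind (suc i ℕ.≟ v) (G (+ i)))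
    ≡⟨ cong₂ _+_ above (below v v<N) ⟩
  G (+ suc v) + G (+ v - 1ℤ) ∎
  where
  open ≡-Reasoning
  not-both : ∀ {i} → suc v ≡ i → suc i ≡ v → ⊥
  not-both refl v+2≡v = ℕP.<-irrefl (sym v+2≡v) (ℕP.m<n+m v (s≤s z≤n))
  above : sumTo N (λ i → ind (suc v ℕ.≟ i) (G (+ i))) ≡ G (+ suc v)
  above = trans (sumTo-cong N (λ i → ind-cong sym sym (suc v ℕ.≟ i) (i ℕ.≟ suc v)))
         (trans (sumTo-δ N (suc v) (G ∘ +_)) (ind-id (suc v ℕ.<? N) at-N))
    where
    at-N : ¬ suc v ℕ.< N → G (+ suc v) ≡ 0ℤ
    at-N v+1≮N = trans (cong (G ∘ +_) (ℕP.≤-antisym v<N (ℕP.≮⇒≥ v+1≮N))) G[N]≡0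
  below : ∀ v → v ℕ.< N → sumTo N (λ i → ind (suc i ℕ.≟ v) (G (+ i))) ≡ G (+ v - 1ℤ)
  below zero    _ = trans (sumTo-zero N (λ i → ind-no (suc i ℕ.≟ 0) {G (+ i)} λ ())) (sym G[-1]≡0)
  below (suc v) v+1<N =
    trans (sumTo-cong N (λ i → ind-cong ℕP.suc-injective (cong suc) (suc i ℕ.≟ suc v) (i ℕ.≟ v)))
          (trans (sumTo-δ N v (G ∘ +_)) (ind-yes (v ℕ.<? N) (ℕP.<-trans (ℕP.n<1+n v) v+1<N)))

-- Lattice paths in the strip of the statement

module LatticePaths (k : ℕ) where

  open Strip (- (+ (suc k / 2))) (+ (k / 2))

  -- InA n k is ValidFrom (+ 0), definitionally.
  ValidFrom : ℤ → {n : ℕ} → Vec Step n → Set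
  ValidFrom h p = ((finalHeight h p ≡ + 0) ⊎ (finalHeight h p ≡ - (+ 1))) × All (InStrip k) (heights h p)

  validFrom? : (h : ℤ) → {n : ℕ} → Decidable (ValidFrom h {n})
  validFrom? h p = ((finalHeight h p ℤ.≟ + 0) ⊎-dec (finalHeight h p ℤ.≟ - (+ 1)))
                   ×-dec All.all? (inStrip? k) (heights h p)

  count-valid : ∀ n h → + length (filter (validFrom? h) (allVecs allSteps n)) ≡ walk n (box 1) h
  count-valid zero h = begin
    + length (filter (validFrom? h) ([] ∷ []))
      ≡⟨ length-filter-[x] (validFrom? h) [] ⟩
    ind (validFrom? h []) 1ℤ
      ≡⟨ ind-cong (λ { (e , (i ∷ [])) → i , e }) (λ { (i , e) → e , (i ∷ []) })
                  (validFrom? h []) (inside? h ×-dec ((h ℤ.≟ 0ℤ) ⊎-dec (h ℤ.≟ - 1ℤ))) ⟩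
    ind (inside? h ×-dec ((h ℤ.≟ 0ℤ) ⊎-dec (h ℤ.≟ - 1ℤ))) 1ℤ
      ≡⟨ ind-× (inside? h) ((h ℤ.≟ 0ℤ) ⊎-dec (h ℤ.≟ - 1ℤ)) ⟩
    ind (inside? h) (ind ((h ℤ.≟ 0ℤ) ⊎-dec (h ℤ.≟ - 1ℤ)) 1ℤ)
      ≡⟨ cong (ind (inside? h)) (box-one h) ⟩
    walk zero (box 1) h ∎
    where open ≡-Reasoning
  count-valid (suc n) h with inside? h
  ... | no out = trans (cong (λ ps → + length ps) (LP.filter-none (validFrom? h) none-valid))
                       (sym (walk-outside (suc n) (box 1) out))
    where
    none-valid : All (λ p → ¬ ValidFrom h p) (allVecs allSteps (suc n))
    none-valid = All.universal (λ { (_ ∷ _) (_ , (h-inside ∷ _)) → out h-inside }) _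
  ... | yes ins = begin
    + length (filter (validFrom? h) (concatMap (λ s → map (s ∷_) paths) allSteps))
      ≡⟨ cong +_ (length-filter-concatMap (validFrom? h) (λ s → map (s ∷_) paths) allSteps) ⟩
    + (count U ℕ.+ (count D ℕ.+ 0))
      ≡⟨ cong (λ c → + (count U ℕ.+ c)) (ℕP.+-identityʳ (count D)) ⟩
    + count U + + count D
      ≡⟨ cong₂ (λ a b → + a + + b) (after U) (after D) ⟩
    + length (filter (validFrom? (h + 1ℤ)) paths) + + length (filter (validFrom? (h - 1ℤ)) paths)
      ≡⟨ cong₂ _+_ (count-valid n (h + 1ℤ)) (count-valid n (h - 1ℤ)) ⟩
    walk n (box 1) (h + 1ℤ) + walk n (box 1) (h - 1ℤ)
      ≡⟨ sym (step-inside (walk n (box 1)) ins) ⟩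
    walk (suc n) (box 1) h ∎
    where
    open ≡-Reasoning
    paths : List (Vec Step n)
    paths = allVecs allSteps n
    count : Step → ℕ
    count s = length (filter (validFrom? h) (map (s ∷_) paths))
    after : ∀ s → count s ≡ length (filter (validFrom? (h + stepVal s)) paths)
    after s = length-filter-map (validFrom? h) (validFrom? (h + stepVal s)) (s ∷_)
                (λ { (e , (_ ∷ a)) → e , a }) (λ { (e , a) → e , (ins ∷ a) }) paths

-- Walks on the path graph P_{k+1}

module PathGraph (lo : ℤ) (k : ℕ) where

  open Strip lo (lo + + k)

  vertex-inside : (v : Fin (suc k)) → Inside (lo + + toℕ v)
  vertex-inside v = ℤP.i≤i+j lo (+ toℕ v) , ℤP.+-monoʳ-≤ lo (+≤+ (FP.toℕ≤pred[n] v))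

  count-walks : ∀ n (v : Fin (suc k)) →
    + length (filter (isWalkFrom? v) (allVecs (allFin (suc k)) n)) ≡ walk n (λ _ → 1ℤ) (lo + + toℕ v)
  count-walks zero v = sym (ind-yes (inside? (lo + + toℕ v)) (vertex-inside v))
  count-walks (suc n) v = begin
    + length (filter (isWalkFrom? v) (concatMap (λ w → map (w ∷_) walks) (allFin (suc k))))
      ≡⟨ cong +_ (length-filter-concatMap (isWalkFrom? v) (λ w → map (w ∷_) walks) (allFin (suc k))) ⟩
    + sum (map (λ w → length (filter (isWalkFrom? v) (map (w ∷_) walks))) (allFin (suc k)))
      ≡⟨ sum-tabulate (suc k) (λ w → w) _ neighbour-weight via-neighbour ⟩
    sumTo (suc k) neighbour-weight
      ≡⟨ sumTo-neighbours (suc k) (toℕ v) G (walk-outside n _ lo-1-outside)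
                          (walk-outside n _ above-top) (FP.toℕ<n v) ⟩
    G (+ suc (toℕ v)) + G (+ toℕ v - 1ℤ)
      ≡⟨ cong₂ _+_ (cong (walk n _) (up lo (+ toℕ v))) (cong (walk n _) (down lo (+ toℕ v))) ⟩
    walk n (λ _ → 1ℤ) (lo + + toℕ v + 1ℤ) + walk n (λ _ → 1ℤ) (lo + + toℕ v - 1ℤ)
      ≡⟨ sym (step-inside (walk n (λ _ → 1ℤ)) (vertex-inside v)) ⟩
    walk (suc n) (λ _ → 1ℤ) (lo + + toℕ v) ∎
    where
    open ≡-Reasoning
    walks : List (Vec (Fin (suc k)) n)
    walks = allVecs (allFin (suc k)) n
    G : ℤ → ℤ
    G x = walk n (λ _ → 1ℤ) (lo + x)
    neighbour-weight : ℕ → ℤ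
    neighbour-weight i = ind ((suc (toℕ v) ℕ.≟ i) ⊎-dec (suc i ℕ.≟ toℕ v)) (G (+ i))
    via-neighbour : ∀ w → + length (filter (isWalkFrom? v) (map (w ∷_) walks))
                          ≡ ind (adj? v w) (G (+ toℕ w))
    via-neighbour w =
      trans (cong +_ (length-filter-map (isWalkFrom? v) (λ ws → adj? v w ×-dec isWalkFrom? w ws)
                                        (w ∷_) (λ p → p) (λ p → p) walks))
            (trans (length-filter-× (adj? v w) (isWalkFrom? w) walks)
                   (cong (ind (adj? v w)) (count-walks n w)))
    above-top : ¬ Inside (lo + + suc k)
    above-top (_ , top≤lo+k) = ℤP.<⇒≱ (ℤP.+-monoʳ-< lo (+<+ (ℕP.n<1+n k))) top≤lo+k
    up : ∀ l i → l + (1ℤ + i) ≡ l + i + 1ℤ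
    up = solve-∀
    down : ∀ l i → l + (i - 1ℤ) ≡ l + i - 1ℤ
    down = solve-∀

n/2≡⌊n/2⌋ : ∀ n → n / 2 ≡ ⌊ n /2⌋
n/2≡⌊n/2⌋ zero          = refl
n/2≡⌊n/2⌋ (suc zero)    = refl
n/2≡⌊n/2⌋ (suc (suc n)) =
  trans (m/n≡1+[m∸n]/n {suc (suc n)} {2} (s≤s (s≤s z≤n))) (cong suc (n/2≡⌊n/2⌋ n))

n/2≤[1+n]/2 : ∀ n → n / 2 ℕ.≤ suc n / 2
n/2≤[1+n]/2 n =
  subst₂ ℕ._≤_ (sym (n/2≡⌊n/2⌋ n)) (sym (n/2≡⌊n/2⌋ (suc n))) (ℕP.⌊n/2⌋≤⌈n/2⌉ n)

[1+n]/2≤1+n/2 : ∀ n → suc n / 2 ℕ.≤ suc (n / 2)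
[1+n]/2≤1+n/2 n =
  subst₂ ℕ._≤_ (sym (n/2≡⌊n/2⌋ (suc n))) (cong suc (sym (n/2≡⌊n/2⌋ n)))
               (ℕP.⌊n/2⌋-mono (ℕP.n≤1+n (suc n)))

n/2+[1+n]/2≡n : ∀ n → n / 2 ℕ.+ suc n / 2 ≡ n
n/2+[1+n]/2≡n n =
  trans (cong₂ ℕ._+_ (n/2≡⌊n/2⌋ n) (n/2≡⌊n/2⌋ (suc n))) (ℕP.⌊n/2⌋+⌈n/2⌉≡n n)

proposition2 : (n k : ℕ) → a n k ≡ pathWalks n k
proposition2 n k = ℤP.+-injective (begin
  + a n k
    ≡⟨ LatticePaths.count-valid k n 0ℤ ⟩
  Strip.walk lo (+ h) n (box 1) 0ℤ
    ≡⟨ CentredStrip.middle≡bottom m h (n/2≤[1+n]/2 k) ([1+n]/2≤1+n/2 k) n ⟩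
  Strip.walk lo (+ h) n (λ _ → 1ℤ) lo
    ≡⟨ cong₂ (λ hi s → Strip.walk lo hi n (λ _ → 1ℤ) s) top (sym (ℤP.+-identityʳ lo)) ⟩
  Strip.walk lo (lo + + k) n (λ _ → 1ℤ) (lo + + 0)
    ≡⟨ sym (PathGraph.count-walks lo k n Fin.zero) ⟩
  + pathWalks n k ∎)
  where
  open ≡-Reasoning
  m h : ℕ
  m = suc k / 2
  h = k / 2
  lo : ℤ
  lo = - + m
  top : + h ≡ lo + + k
  top = trans (shift (+ h) (+ m)) (cong (λ t → lo + + t) (n/2+[1+n]/2≡n k))
    where
    shift : ∀ x y → x ≡ - y + (x + y)
    shift = solve-∀
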